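{- For all integers $r \geq 3$, $t \geq r$ and $s \geq 0$, as $S\to\infty$, $$e_{r+s,t+s}(S) \ll e_{r,t}(S) \quad\text{and}\quad e'_{r+s,t+s}(S) \ll e'_{r,t}(S).$$
   Context: All graphs are finite and simple. For $r\ge 3$, an $r$-system is a pair $(H,\mathcal{F})$ where $H$ is a graph and $\mathcal{F}$ is a family of subsets of $V(H)$ such that: (i) $H$ contains no $K_r$; (ii) every $S\in\mathcal{F}$ is maximally $K_{r-1}$-free ($H[S]$ has no $K_{r-1}$ but $H[S\cup\{v\}]$ has a $K_{r-1}$ for every $v\notin S$); (iii) for distinct $S\neq T$ in $\mathcal{F}$, $H[S\cap T]$ contains a $K_{r-2}$. It is maximal if for every non-edge $e$ of $H$, either $H+e$ contains $K_r$ or $(H+e)[S]$ contains $K_{r-1}$ for some $S\in\mathcal{F}$. An $(r,t)$-system (resp. maximal $(r,t)$-system) is an $r$-system (resp. maximal $r$-system) with no repeated sets in $\mathcal{F}$ and all sets of size exactly $t$. For $t\ge r$, $e_{r,t}(S)$ (resp. $e'_{r,t}(S)$) is the minimum number of edges of $H$ over $(r,t)$-systems (resp. maximal $(r,t)$-systems) $(H,\mathcal{F})$ with $|\mathcal{F}|=S$. $f\ll g$ means $f=O(g)$, with constants depending on $r,t,s$. -}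

module Defs where

open import Data.Nat using (ℕ; zero; suc; _+_; _*_; _∸_; _≤_; _<ᵇ_)
open import Data.Bool using (Bool; true; false; _∨_; _∧_; if_then_else_)
open import Data.Fin using (Fin; toℕ; _≟_)
open import Data.Fin.Subset using (Subset; _∈_; _⊆_; _∩_; _∪_; ⁅_⁆; ∣_∣; ⊤)
open import Data.List using (List; length; map; concatMap; allFin)
open import Data.Nat.ListAction using (sum)
open import Data.List.Relation.Unary.All using (All)
open import Data.List.Relation.Unary.Any using (Any)
open import Data.List.Relation.Unary.AllPairs using (AllPairs)
open import Data.List.Relation.Unary.Unique.Propositional using (Unique)
open import Data.Product using (Σ; _×_; ∃-syntax)
open import Data.Sum using (_⊎_)
open import Relation.Binary.PropositionalEquality using (_≡_; _≢_)
open import Relation.Nullary using (¬_; does)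

record Graph (n : ℕ) : Set where
  field
    adj   : Fin n → Fin n → Bool
    sym   : ∀ i j → adj i j ≡ adj j i
    irrefl : ∀ i → adj i i ≡ false
open Graph public

edgeCount : ∀ {n} → Graph n → ℕ
edgeCount {n} G =
  sum (concatMap (λ i → map (λ j → if adj G i j ∧ (toℕ i <ᵇ toℕ j) then 1 else 0)
                            (allFin n))
                 (allFin n))

HasCliqueR : ∀ {n} → (Fin n → Fin n → Set) → Subset n → ℕ → Set
HasCliqueR {n} R X k =
  Σ (Subset n) λ C → C ⊆ X × ∣ C ∣ ≡ k ×
    (∀ i j → i ∈ C → j ∈ C → i ≢ j → R i j)

Adj : ∀ {n} → Graph n → Fin n → Fin n → Set
Adj G i j = adj G i j ≡ true

AdjPlus : ∀ {n} → Graph n → Fin n → Fin n → Fin n → Fin n → Set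
AdjPlus G u v i j = Adj G i j ⊎ ((i ≡ u × j ≡ v) ⊎ (i ≡ v × j ≡ u))

HasClique : ∀ {n} → Graph n → Subset n → ℕ → Set
HasClique G X k = HasCliqueR (Adj G) X k

HasClique+ : ∀ {n} → Graph n → Fin n → Fin n → Subset n → ℕ → Set
HasClique+ G u v X k = HasCliqueR (AdjPlus G u v) X k

MaxFree : ∀ {n} → ℕ → Graph n → Subset n → Set
MaxFree {n} r G S =
  ¬ HasClique G S (r ∸ 1) ×
  (∀ (v : Fin n) → ¬ (v ∈ S) → HasClique G (S ∪ ⁅ v ⁆) (r ∸ 1))

IsRSystem : ∀ {n} → ℕ → Graph n → List (Subset n) → Set
IsRSystem r G F =
  ¬ HasClique G ⊤ r ×
  All (MaxFree r G) F ×
  AllPairs (λ S T → HasClique G (S ∩ T) (r ∸ 2)) F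

IsMaximal : ∀ {n} → ℕ → Graph n → List (Subset n) → Set
IsMaximal {n} r G F =
  ∀ (u v : Fin n) → u ≢ v → adj G u v ≡ false →
    HasClique+ G u v ⊤ r ⊎ Any (λ S → HasClique+ G u v S (r ∸ 1)) F

IsRTSystem : ∀ {n} → ℕ → ℕ → Graph n → List (Subset n) → Set
IsRTSystem r t G F = IsRSystem r G F × Unique F × All (λ S → ∣ S ∣ ≡ t) F

IsMaxRTSystem : ∀ {n} → ℕ → ℕ → Graph n → List (Subset n) → Set
IsMaxRTSystem r t G F = IsRTSystem r t G F × IsMaximal r G F

SysProp : Set₁
SysProp = ℕ → ℕ → ∀ {n} → Graph n → List (Subset n) → Set

-- "min over systems with |F| = S of e(H) equals m"  (e_{r,t}(S) = m)
IsMinEdges : SysProp → ℕ → ℕ → ℕ → ℕ → Set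
IsMinEdges P r t S m =
  (∃[ n ] Σ (Graph n) λ G → Σ (List (Subset n)) λ F →
      P r t G F × length F ≡ S × edgeCount G ≡ m) ×
  (∀ n (G : Graph n) (F : List (Subset n)) →
      P r t G F → length F ≡ S → m ≤ edgeCount G)

-- "min over systems with |F| = S of e(H) is ≤ X"  (e_{r,t}(S) ≤ X)
MinEdges≤ : SysProp → ℕ → ℕ → ℕ → ℕ → Set
MinEdges≤ P r t S X =
  ∃[ n ] Σ (Graph n) λ G → Σ (List (Subset n)) λ F →
      P r t G F × length F ≡ S × edgeCount G ≤ X

Dominated : SysProp → ℕ → ℕ → ℕ → Set
Dominated P r t s =
  ∃[ C ] ∃[ S₀ ] ∀ S → S₀ ≤ S → ∀ m → IsMinEdges P r t S m →
    MinEdges≤ P (r + s) (t + s) S (C * m)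

{-# OPTIONS --safe #-}
module Submission where

-- Adding a vertex joined to everything (a cone apex) to H and to every set of F turns an
-- (r,t)-system into an (r+1,t+1)-system, maximal if the original was: cliques, maximal
-- K_{r-1}-freeness, the K_{r-2} meets and maximality all shift by one. Iterating s times
-- adds at most s(s+n) edges to an n-vertex H. Since r ≥ 3, every vertex outside a maximally
-- K_{r-1}-free set S has a neighbour, so n ≤ t + 2e(H) by the handshake lemma; and two
-- distinct sets in F force e(H) ≥ 1. Hence s(s+n) + e(H) ≤ C(s,t)·e(H).

open import Defs hiding (sym)
open import Data.Bool using (Bool; true; false; if_then_else_; _∧_)
open import Data.Bool.Properties using (∧-identityʳ; T-≡)
open import Data.Empty using (⊥-elim)
open import Data.Fin using (Fin; zero; suc; toℕ; _≟_)
open import Data.Fin.Properties using (toℕ-injective; suc-injective; any?)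
open import Data.Fin.Subset using (Subset; _∈_; _∉_; _⊆_; _∪_; ⁅_⁆; ∣_∣; ⊤; ⊥)
open import Data.Fin.Subset.Properties
  using ( _∈?_; ⊥⊆; ∣⊥∣≡0; in⊆in; out⊆; drop-∷-⊆; x∈p∪q⁻; x∈⁅y⁆⇒x≡y; x∈⁅x⁆
        ; p⊆q⇒∣p∣≤∣q∣; ∣⁅x⁆∣≡1; ∣p∣≤n; ∣p∣≡n⇒p≡⊤)
open import Data.List using (List; []; _∷_; length; map; concatMap; tabulate; allFin)
open import Data.List.Properties using (length-map; map-id; map-∘)
import Data.List.Relation.Unary.All as All
import Data.List.Relation.Unary.All.Properties as All
import Data.List.Relation.Unary.Any as Any
import Data.List.Relation.Unary.Any.Properties as Any
import Data.List.Relation.Unary.AllPairs as AllPairs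
import Data.List.Relation.Unary.AllPairs.Properties as AllPairs
import Data.List.Relation.Unary.Unique.Propositional.Properties as Unique
open import Data.Nat using (ℕ; zero; suc; _+_; _*_; _≤_; _<ᵇ_; z≤n; s≤s; s≤s⁻¹; >-nonZero)
import Data.Nat.ListAction as List
open import Data.Nat.ListAction.Properties using (sum-++)
open import Data.Nat.Properties hiding (_≟_; suc-injective)
open import Algebra.Properties.CommutativeMonoid.Sum +-0-commutativeMonoid
  using (sum; sum-syntax; sum-cong-≗; ∑-distrib-+; ∑-comm)
open import Data.Nat.Tactic.RingSolver using (solve-∀)
open import Data.Product using (_×_; _,_; proj₁; ∃-syntax)
import Data.Product as Product
import Data.Sum as Sum
open import Data.Sum using (inj₁; inj₂)
open import Data.Vec using ([]; _∷_; lookup; _++_)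
open import Data.Vec.Properties using (∷-injectiveʳ; []=⇒lookup)
open import Data.Vec.Base using (here; there)
open import Function using (_∘_; id)
open import Function.Bundles using (Equivalence)
open import Relation.Binary using (tri<; tri≈; tri>)
open import Relation.Binary.PropositionalEquality
open import Relation.Nullary using (¬_; yes; no)
open import Relation.Nullary.Decidable using (_×-dec_; ¬?)

𝟙 : Bool → ℕ
𝟙 b = if b then 1 else 0

∑-mono-≤ : ∀ {n} {f g : Fin n → ℕ} → (∀ i → f i ≤ g i) → sum f ≤ sum g
∑-mono-≤ {zero}  _   = z≤n
∑-mono-≤ {suc n} f≤g = +-mono-≤ (f≤g zero) (∑-mono-≤ (f≤g ∘ suc))

∑-one : ∀ n → ∑[ i < n ] 1 ≡ n
∑-one zero    = refl
∑-one (suc n) = cong suc (∑-one n)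

term≤∑ : ∀ {n} (f : Fin n → ℕ) i → f i ≤ sum f
term≤∑ f zero    = m≤m+n _ _
term≤∑ f (suc i) = ≤-trans (term≤∑ (f ∘ suc) i) (m≤n+m _ _)

∑-𝟙-lookup : ∀ {n} (S : Subset n) → ∑[ i < n ] 𝟙 (lookup S i) ≡ ∣ S ∣
∑-𝟙-lookup []          = refl
∑-𝟙-lookup (true ∷ S)  = cong suc (∑-𝟙-lookup S)
∑-𝟙-lookup (false ∷ S) = ∑-𝟙-lookup S

sum-map-tabulate : ∀ {A : Set} {n} (f : A → ℕ) (g : Fin n → A) →
                   List.sum (map f (tabulate g)) ≡ ∑[ i < n ] f (g i)
sum-map-tabulate {n = zero}  f g = refl
sum-map-tabulate {n = suc n} f g = cong (f (g zero) +_) (sum-map-tabulate f (g ∘ suc))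

sum-concatMap-tabulate : ∀ {A : Set} {n} (f : A → List ℕ) (g : Fin n → A) →
                         List.sum (concatMap f (tabulate g)) ≡ ∑[ i < n ] List.sum (f (g i))
sum-concatMap-tabulate {n = zero}  f g = refl
sum-concatMap-tabulate {n = suc n} f g =
  trans (sum-++ (f (g zero)) _) (cong (List.sum (f (g zero)) +_) (sum-concatMap-tabulate f (g ∘ suc)))

edge< : ∀ {n} → Graph n → Fin n → Fin n → ℕ
edge< G i j = 𝟙 (adj G i j ∧ (toℕ i <ᵇ toℕ j))

edgeCount-∑ : ∀ {n} (G : Graph n) → edgeCount G ≡ ∑[ i < n ] ∑[ j < n ] edge< G i j
edgeCount-∑ {n} G = trans (sum-concatMap-tabulate (λ i → map (edge< G i) (allFin n)) id)
                          (sum-cong-≗ (λ i → sum-map-tabulate (edge< G i) id))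

degree : ∀ {n} → Graph n → Fin n → ℕ
degree {n} G i = ∑[ j < n ] 𝟙 (adj G i j)

adj⇒1≤degree : ∀ {n} (G : Graph n) {i j} → Adj G i j → 1 ≤ degree G i
adj⇒1≤degree G {i} {j} i~j = subst (λ b → 𝟙 b ≤ degree G i) i~j (term≤∑ (𝟙 ∘ adj G i) j)

𝟙-adj≤edge<+edge< : ∀ {n} (G : Graph n) i j → 𝟙 (adj G i j) ≤ edge< G i j + edge< G j i
𝟙-adj≤edge<+edge< G i j with <-cmp (toℕ i) (toℕ j)
... | tri< i<j _ _ rewrite Equivalence.to T-≡ (<⇒<ᵇ i<j) | ∧-identityʳ (adj G i j) = m≤m+n _ _
... | tri> _ _ j<i
  rewrite Equivalence.to T-≡ (<⇒<ᵇ j<i) | ∧-identityʳ (adj G j i) | Graph.sym G i j = m≤n+m _ _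
... | tri≈ _ i≡j _ rewrite toℕ-injective i≡j | irrefl G j = z≤n

handshake : ∀ {n} (G : Graph n) → ∑[ i < n ] degree G i ≤ edgeCount G + edgeCount G
handshake {n} G = begin
  ∑[ i < n ] degree G i
    ≤⟨ ∑-mono-≤ (λ i → ∑-mono-≤ (𝟙-adj≤edge<+edge< G i)) ⟩
  ∑[ i < n ] ∑[ j < n ] (edge< G i j + edge< G j i)
    ≡⟨ sum-cong-≗ (λ i → ∑-distrib-+ (edge< G i) (λ j → edge< G j i)) ⟩
  ∑[ i < n ] (∑[ j < n ] edge< G i j + ∑[ j < n ] edge< G j i)
    ≡⟨ ∑-distrib-+ (λ i → ∑[ j < n ] edge< G i j) (λ i → ∑[ j < n ] edge< G j i) ⟩
  ∑[ i < n ] ∑[ j < n ] edge< G i j + ∑[ i < n ] ∑[ j < n ] edge< G j i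
    ≡⟨ cong (∑[ i < n ] ∑[ j < n ] edge< G i j +_) (∑-comm (λ i j → edge< G j i)) ⟩
  ∑[ i < n ] ∑[ j < n ] edge< G i j + ∑[ j < n ] ∑[ i < n ] edge< G j i
    ≡⟨ cong₂ _+_ (edgeCount-∑ G) (edgeCount-∑ G) ⟨
  edgeCount G + edgeCount G ∎
  where open ≤-Reasoning

⊆-ofSize : ∀ {n} (X : Subset n) {k} → k ≤ ∣ X ∣ → ∃[ D ] D ⊆ X × ∣ D ∣ ≡ k
⊆-ofSize {n} X {zero} _ = ⊥ , ⊥⊆ , ∣⊥∣≡0 n
⊆-ofSize (true ∷ X) {suc k} (s≤s k≤∣X∣) =
  let D , D⊆X , ∣D∣≡k = ⊆-ofSize X k≤∣X∣ in true ∷ D , in⊆in D⊆X , cong suc ∣D∣≡k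
⊆-ofSize (false ∷ X) {suc k} k<∣X∣ =
  let D , D⊆X , ∣D∣≡k = ⊆-ofSize X k<∣X∣ in false ∷ D , out⊆ D⊆X , ∣D∣≡k

∣x∷p∣≤1+∣p∣ : ∀ {n} x (p : Subset n) → ∣ x ∷ p ∣ ≤ suc ∣ p ∣
∣x∷p∣≤1+∣p∣ true  p = ≤-refl
∣x∷p∣≤1+∣p∣ false p = n≤1+n ∣ p ∣

∃-≢-∈ : ∀ {n} {C : Subset n} v → 2 ≤ ∣ C ∣ → ∃[ w ] w ∈ C × w ≢ v
∃-≢-∈ {C = C} v 2≤∣C∣ with any? (λ w → (w ∈? C) ×-dec ¬? (w ≟ v))
... | yes w∈C≢v = w∈C≢v
... | no none   = ⊥-elim (<⇒≱ 2≤∣C∣ (≤-trans (p⊆q⇒∣p∣≤∣q∣ C⊆⁅v⁆) (≤-reflexive (∣⁅x⁆∣≡1 v))))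
  where
  C⊆⁅v⁆ : C ⊆ ⁅ v ⁆
  C⊆⁅v⁆ {w} w∈C with w ≟ v
  ... | yes refl = x∈⁅x⁆ v
  ... | no w≢v   = ⊥-elim (none (w , w∈C , w≢v))

module _ {n : ℕ} (G : Graph n) where

  saturating-vertex-has-neighbour : ∀ {S : Subset n} {v k} → 2 ≤ k → ¬ HasClique G S k →
                                    HasClique G (S ∪ ⁅ v ⁆) k → ∃[ w ] Adj G v w
  saturating-vertex-has-neighbour {S} {v} 2≤k free (C , C⊆S∪v , ∣C∣≡k , clique) with v ∈? C
  ... | no v∉C = ⊥-elim (free (C , C⊆S , ∣C∣≡k , clique))
    where
    C⊆S : C ⊆ S
    C⊆S {x} x∈C with x∈p∪q⁻ S ⁅ v ⁆ (C⊆S∪v x∈C)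
    ... | inj₁ x∈S = x∈S
    ... | inj₂ x∈v = ⊥-elim (v∉C (subst (_∈ C) (x∈⁅y⁆⇒x≡y v x∈v) x∈C))
  ... | yes v∈C =
    let w , w∈C , w≢v = ∃-≢-∈ v (subst (2 ≤_) (sym ∣C∣≡k) 2≤k) in w , clique v w v∈C w∈C (w≢v ∘ sym)

  vertexCount≤ : ∀ {r} {S : Subset n} → 3 ≤ r → MaxFree r G S → n ≤ ∣ S ∣ + (edgeCount G + edgeCount G)
  vertexCount≤ {S = S} (s≤s (s≤s (s≤s _))) (free , saturated) = begin
    n                                              ≡⟨ ∑-one n ⟨
    ∑[ i < n ] 1                                   ≤⟨ ∑-mono-≤ covered ⟩
    ∑[ i < n ] (𝟙 (lookup S i) + degree G i)       ≡⟨ ∑-distrib-+ (𝟙 ∘ lookup S) (degree G) ⟩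
    ∑[ i < n ] 𝟙 (lookup S i) + ∑[ i < n ] degree G i
      ≤⟨ +-mono-≤ (≤-reflexive (∑-𝟙-lookup S)) (handshake G) ⟩
    ∣ S ∣ + (edgeCount G + edgeCount G)            ∎
    where
    open ≤-Reasoning
    covered : ∀ i → 1 ≤ 𝟙 (lookup S i) + degree G i
    covered i with i ∈? S
    ... | yes i∈S rewrite []=⇒lookup i∈S = s≤s z≤n
    ... | no i∉S  =
      let _ , i~w = saturating-vertex-has-neighbour (s≤s (s≤s z≤n)) free (saturated i i∉S)
      in ≤-trans (adj⇒1≤degree G i~w) (m≤n+m _ _)

  edgeless-maxFree⇒⊤ : ∀ {r} {S : Subset n} → 3 ≤ r → MaxFree r G S → edgeCount G ≡ 0 → S ≡ ⊤
  edgeless-maxFree⇒⊤ {S = S} 3≤r maxFree e≡0 = ∣p∣≡n⇒p≡⊤ (≤-antisym (∣p∣≤n S) n≤∣S∣)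
    where
    n≤∣S∣ : n ≤ ∣ S ∣
    n≤∣S∣ = ≤-trans (vertexCount≤ 3≤r maxFree)
                    (≤-reflexive (trans (cong (λ e → ∣ S ∣ + (e + e)) e≡0) (+-identityʳ ∣ S ∣)))

  twoSets⇒1≤edgeCount : ∀ {r t} {S₁ S₂ : Subset n} {F} → 3 ≤ r → IsRTSystem r t G (S₁ ∷ S₂ ∷ F) →
                         1 ≤ edgeCount G
  twoSets⇒1≤edgeCount 3≤r ((_ , mf₁ All.∷ mf₂ All.∷ _ , _) , (S₁≢S₂ All.∷ _) AllPairs.∷ _ , _) =
    n≢0⇒n>0 λ e≡0 → S₁≢S₂ (trans (edgeless-maxFree⇒⊤ 3≤r mf₁ e≡0) (sym (edgeless-maxFree⇒⊤ 3≤r mf₂ e≡0)))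

  system-vertexCount≤ : ∀ {r t} {S : Subset n} {F} → 3 ≤ r → IsRTSystem r t G (S ∷ F) →
                        n ≤ t + (edgeCount G + edgeCount G)
  system-vertexCount≤ 3≤r ((_ , maxFree All.∷ _ , _) , _ , ∣S∣≡t All.∷ _) =
    subst (λ k → n ≤ k + _) ∣S∣≡t (vertexCount≤ 3≤r maxFree)

cone : ∀ {n} → Graph n → Graph (suc n)
cone {n} G = record { adj = coneAdj ; sym = coneSym ; irrefl = coneIrrefl }
  where
  coneAdj : Fin (suc n) → Fin (suc n) → Bool
  coneAdj zero    zero    = false
  coneAdj zero    (suc _) = true
  coneAdj (suc _) zero    = true
  coneAdj (suc i) (suc j) = adj G i j
  coneSym : ∀ i j → coneAdj i j ≡ coneAdj j i
  coneSym zero    zero    = refl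
  coneSym zero    (suc _) = refl
  coneSym (suc _) zero    = refl
  coneSym (suc i) (suc j) = Graph.sym G i j
  coneIrrefl : ∀ i → coneAdj i i ≡ false
  coneIrrefl zero    = refl
  coneIrrefl (suc i) = irrefl G i

edgeCount-cone : ∀ {n} (G : Graph n) → edgeCount (cone G) ≡ n + edgeCount G
edgeCount-cone {n} G = begin
  -- the apex row of the double sum reduces to ∑ 1 and the apex column to 0
  edgeCount (cone G)                                  ≡⟨ edgeCount-∑ (cone G) ⟩
  ∑[ j < n ] 1 + ∑[ i < n ] ∑[ j < n ] edge< G i j    ≡⟨ cong₂ _+_ (∑-one n) (sym (edgeCount-∑ G)) ⟩
  n + edgeCount G                                     ∎
  where open ≡-Reasoning

module _ {n : ℕ} {R : Fin n → Fin n → Set} {R′ : Fin (suc n) → Fin (suc n) → Set} where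

  clique-cone : (∀ {i j} → R i j → R′ (suc i) (suc j)) → (∀ j → R′ zero (suc j)) → (∀ i → R′ (suc i) zero) →
                ∀ {X k} → HasCliqueR R X k → HasCliqueR R′ (true ∷ X) (suc k)
  clique-cone lift apexˡ apexʳ (C , C⊆X , ∣C∣≡k , clique) = true ∷ C , in⊆in C⊆X , cong suc ∣C∣≡k , clique′
    where
    clique′ : ∀ i j → i ∈ true ∷ C → j ∈ true ∷ C → i ≢ j → R′ i j
    clique′ zero    zero    _           _           0≢0 = ⊥-elim (0≢0 refl)
    clique′ zero    (suc j) _           _           _   = apexˡ j
    clique′ (suc i) zero    _           _           _   = apexʳ i
    clique′ (suc i) (suc j) (there i∈C) (there j∈C) i≢j = lift (clique i j i∈C j∈C (i≢j ∘ cong suc))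

  clique-uncone : (∀ {i j} → R′ (suc i) (suc j) → R i j) →
                  ∀ {b X k} → HasCliqueR R′ (b ∷ X) (suc k) → HasCliqueR R X k
  clique-uncone lower (c ∷ C , cC⊆bX , ∣cC∣≡1+k , clique)
    with D , D⊆C , ∣D∣≡k ← ⊆-ofSize C (s≤s⁻¹ (subst (_≤ suc ∣ C ∣) ∣cC∣≡1+k (∣x∷p∣≤1+∣p∣ c C))) =
    D , drop-∷-⊆ cC⊆bX ∘ D⊆C , ∣D∣≡k ,
    λ i j i∈D j∈D i≢j →
      lower (clique (suc i) (suc j) (there (D⊆C i∈D)) (there (D⊆C j∈D)) (i≢j ∘ suc-injective))

module _ {n : ℕ} {G : Graph n} where

  cone-clique : ∀ {X k} → HasClique G X k → HasClique (cone G) (true ∷ X) (suc k)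
  cone-clique = clique-cone id (λ _ → refl) (λ _ → refl)

  cone-clique+ : ∀ {a b X k} → HasClique+ G a b X k → HasClique+ (cone G) (suc a) (suc b) (true ∷ X) (suc k)
  cone-clique+ = clique-cone (Sum.map₂ (Sum.map both-suc both-suc)) (λ _ → inj₁ refl) (λ _ → inj₁ refl)
    where
    both-suc : ∀ {i j k l : Fin n} → i ≡ k × j ≡ l → suc i ≡ suc k × suc j ≡ suc l
    both-suc = Product.map (cong suc) (cong suc)

  cone-uncone : ∀ {b X k} → HasClique (cone G) (b ∷ X) (suc k) → HasClique G X k
  cone-uncone = clique-uncone id

  cone-maxFree : ∀ {r} {S : Subset n} → MaxFree (suc r) G S → MaxFree (suc (suc r)) (cone G) (true ∷ S)
  cone-maxFree {S = S} (free , saturated) = free ∘ cone-uncone , saturated′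
    where
    saturated′ : ∀ v → v ∉ true ∷ S → HasClique (cone G) ((true ∷ S) ∪ ⁅ v ⁆) _
    saturated′ zero    v∉ = ⊥-elim (v∉ here)
    saturated′ (suc a) v∉ = cone-clique (saturated a (v∉ ∘ there))

  -- Matching on 2 ≤ r makes r ∸ 1 and r ∸ 2 commute with suc definitionally.
  cone-isRTSystem : ∀ {r t F} → 2 ≤ r → IsRTSystem r t G F →
                    IsRTSystem (suc r) (suc t) (cone G) (map (true ∷_) F)
  cone-isRTSystem (s≤s (s≤s _)) ((noClique , maxFree , meets) , unique , sizes) =
    ( noClique ∘ cone-uncone
    , All.map⁺ (All.map cone-maxFree maxFree)
    , AllPairs.map⁺ (AllPairs.map cone-clique meets)) ,
    Unique.map⁺ ∷-injectiveʳ unique ,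
    All.map⁺ (All.map (cong suc) sizes)

  cone-isMaximal : ∀ {r F} → 1 ≤ r → IsMaximal r G F → IsMaximal (suc r) (cone G) (map (true ∷_) F)
  cone-isMaximal (s≤s _) maximal zero    zero    0≢0 _  = ⊥-elim (0≢0 refl)
  cone-isMaximal (s≤s _) maximal zero    (suc _) _   ()
  cone-isMaximal (s≤s _) maximal (suc _) zero    _   ()
  cone-isMaximal (s≤s _) maximal (suc a) (suc b) a≢b a≁b =
    Sum.map cone-clique+ (Any.map⁺ ∘ Any.map cone-clique+) (maximal a b (a≢b ∘ cong suc) a≁b)

ConeStable : SysProp → Set
ConeStable P = ∀ {r t n} {G : Graph n} {F} → 2 ≤ r → P r t G F →
               P (suc r) (suc t) (cone G) (map (true ∷_) F)

isRTSystem-coneStable : ConeStable (λ r t G F → IsRTSystem r t G F)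
isRTSystem-coneStable = cone-isRTSystem

isMaxRTSystem-coneStable : ConeStable (λ r t G F → IsMaxRTSystem r t G F)
isMaxRTSystem-coneStable 2≤r (system , maximal) =
  cone-isRTSystem 2≤r system , cone-isMaximal (≤-trans (s≤s z≤n) 2≤r) maximal

cone^ : ∀ s {n} → Graph n → Graph (s + n)
cone^ zero    G = G
cone^ (suc s) G = cone (cone^ s G)

cone^-stable : ∀ {P} → ConeStable P → ∀ s {r t n} {G : Graph n} {F} → 2 ≤ r → P r t G F →
               P (s + r) (s + t) (cone^ s G) (map (⊤ {s} ++_) F)
cone^-stable {P} stable zero {r} {t} {G = G} {F} _ p = subst (P r t G) (sym (map-id F)) p
cone^-stable {P} stable (suc s) {r} {t} {G = G} {F} 2≤r p =
  subst (P (suc s + r) (suc s + t) (cone^ (suc s) G)) (sym (map-∘ F))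
        (stable (≤-trans 2≤r (m≤n+m r s)) (cone^-stable {P} stable s 2≤r p))

edgeCount-cone^ : ∀ s {n} (G : Graph n) → edgeCount (cone^ s G) ≤ s * (s + n) + edgeCount G
edgeCount-cone^ zero    G = ≤-refl
edgeCount-cone^ (suc s) {n} G = begin
  edgeCount (cone (cone^ s G))                   ≡⟨ edgeCount-cone (cone^ s G) ⟩
  (s + n) + edgeCount (cone^ s G)                ≤⟨ +-monoʳ-≤ (s + n) (edgeCount-cone^ s G) ⟩
  (s + n) + (s * (s + n) + edgeCount G)          ≡⟨ +-assoc (s + n) _ _ ⟨
  suc s * (s + n) + edgeCount G                  ≤⟨ +-monoˡ-≤ _ (*-monoʳ-≤ (suc s) (n≤1+n (s + n))) ⟩
  suc s * (suc s + n) + edgeCount G              ∎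
  where open ≤-Reasoning

dominationConstant : ℕ → ℕ → ℕ
dominationConstant s t = suc (s * (2 + s + t))

s*[s+n]+m≤dominationConstant*m : ∀ s t {n m} → 1 ≤ m → n ≤ t + (m + m) →
                                 s * (s + n) + m ≤ dominationConstant s t * m
s*[s+n]+m≤dominationConstant*m s t {n} {m} 1≤m n≤t+2m = begin
  s * (s + n) + m                     ≤⟨ +-monoˡ-≤ m (*-monoʳ-≤ s (+-monoʳ-≤ s n≤t+2m)) ⟩
  s * (s + (t + (m + m))) + m         ≡⟨ expand s t m ⟩
  s * (s + t) + (2 * s * m + m)       ≤⟨ +-monoˡ-≤ _ (m≤m*n (s * (s + t)) m {{>-nonZero 1≤m}}) ⟩
  s * (s + t) * m + (2 * s * m + m)   ≡⟨ collect s t m ⟩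
  dominationConstant s t * m          ∎
  where
  open ≤-Reasoning
  expand : ∀ s t m → s * (s + (t + (m + m))) + m ≡ s * (s + t) + (2 * s * m + m)
  expand = solve-∀
  collect : ∀ s t m → s * (s + t) * m + (2 * s * m + m) ≡ suc (s * (2 + s + t)) * m
  collect = solve-∀

dominated : ∀ {P} → ConeStable P → (∀ {r t n} {G : Graph n} {F} → P r t G F → IsRTSystem r t G F) →
            ∀ {r t} s → 3 ≤ r → Dominated P r t s
dominated {P} stable sound {r} {t} s 3≤r = dominationConstant s t , 2 , bound
  where
  coned : ∀ {n} (G : Graph n) F → 2 ≤ length F → P r t G F →
          MinEdges≤ P (r + s) (t + s) (length F) (dominationConstant s t * edgeCount G)
  coned G (_ ∷ []) (s≤s ()) _
  coned G F@(_ ∷ _ ∷ _) _ p =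
    _ , cone^ s G , map (⊤ ++_) F ,
    subst₂ (λ r′ t′ → P r′ t′ (cone^ s G) (map (⊤ ++_) F)) (+-comm s r) (+-comm s t)
           (cone^-stable {P} stable s (≤-trans (n≤1+n 2) 3≤r) p) ,
    length-map (⊤ ++_) F ,
    ≤-trans (edgeCount-cone^ s G)
            (s*[s+n]+m≤dominationConstant*m s t (twoSets⇒1≤edgeCount G 3≤r (sound p))
                                                (system-vertexCount≤ G 3≤r (sound p)))
  bound : ∀ S → 2 ≤ S → ∀ m → IsMinEdges P r t S m →
          MinEdges≤ P (r + s) (t + s) S (dominationConstant s t * m)
  bound _ 2≤∣F∣ _ ((_ , G , F , p , refl , refl) , _) = coned G F 2≤∣F∣ p

corollary21 : ∀ (r t s : ℕ) → 3 ≤ r → r ≤ t →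
    Dominated (λ r t G F → IsRTSystem r t G F) r t s ×
    Dominated (λ r t G F → IsMaxRTSystem r t G F) r t s
corollary21 r t s 3≤r _ =
  dominated isRTSystem-coneStable id s 3≤r , dominated isMaxRTSystem-coneStable proj₁ s 3≤r
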